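{- Let $k\ge2$, $N\ge1$ and $n=\lfloor\log_k(N(k-1)+1)\rfloor$. For every integer $i\ge 0$, the number of fires of each vertex on layer $i+1$ is \[f_i(N,k)=\sum_{j=1}^{n-i-1}\left(\frac{k^{j}-1}{k-1}\right)c_{i+j}(N,k)\] (an empty sum being $0$).
   Context: Fix an integer $k\ge 2$. Let $T_k$ be the infinite rooted $k$-ary tree (every vertex has exactly $k$ children) with one additional self-loop at the root, so every vertex has degree $k+1$. A vertex is on layer $i+1$ if its distance from the root is $i$ (the root is on layer 1). Chip-firing: a vertex with at least $k+1$ chips may fire, sending one chip along each incident edge (a non-root vertex sends one chip to its parent and one to each of its $k$ children; the root sends one chip to each of its $k$ children and one chip to itself along the self-loop). Starting with $N$ chips at the root and none elsewhere, vertices fire until no vertex can fire; this terminates, and the stable configuration and the number of times each vertex fires do not depend on the order of firings. All vertices on the same layer carry the same number of chips in the stable configuration and fire the same number of times. For $i\ge0$, $c_i(N,k)$ denotes the number of chips on each vertex of layer $i+1$ in the stable configuration (it equals $a_i+1$ for $0\le i\le n-1$, where $a_{n-1}\dots a_0$ is the base-$k$ expansion of $N-\frac{k^n-1}{k-1}$ with leading zeros), and $f_i(N,k)$ the number of times each vertex of layer $i+1$ fires. -}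

module Defs where

open import Data.Nat using (ℕ; zero; suc; _+_; _*_; _∸_; _^_; _≤_; _<_)
open import Data.Nat.DivMod using (_/_)
open import Data.Fin using (Fin; fromℕ<)
open import Data.Fin.Properties using () renaming (_≟_ to _≟F_)
open import Data.List using (List; []; _∷_; length; filter; replicate)
open import Data.List.Properties using (≡-dec)
open import Data.Bool using (if_then_else_)
open import Relation.Nullary using (does)
open import Relation.Binary.PropositionalEquality using (_≡_)

-- Vertices of the infinite rooted k-ary tree T_k: finite words over Fin k.
-- The root is [], the children of v are (a ∷ v) for a : Fin k, and the
-- parent of (a ∷ v) is v.  The layer of v is (length v + 1).
Vertex : ℕ → Set
Vertex k = List (Fin k)

_≟V_ : {k : ℕ} → (u v : Vertex k) → Relation.Nullary.Dec (u ≡ v)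
_≟V_ = ≡-dec _≟F_

Config : ℕ → Set
Config k = Vertex k → ℕ

ind : {A : Set} → Relation.Nullary.Dec A → ℕ
ind d = if does d then 1 else 0

isRoot : {k : ℕ} → (v : Vertex k) → Relation.Nullary.Dec (v ≡ [])
isRoot v = v ≟V []

gain : {k : ℕ} → Vertex k → Vertex k → ℕ
gain v w = selfLoop + fromParent w + fromChild v
  where
  selfLoop : ℕ
  selfLoop = if does (w ≟V v) then ind (isRoot v) else 0
  fromParent : _ → ℕ
  fromParent []       = 0
  fromParent (_ ∷ w') = ind (w' ≟V v)
  fromChild : _ → ℕ
  fromChild []       = 0
  fromChild (_ ∷ v') = ind (v' ≟V w)

-- Firing v: v sends one chip along each of its k+1 incident edges.
fire : {k : ℕ} → Vertex k → Config k → Config k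
fire {k} v C w = (if does (w ≟V v) then C w ∸ suc k else C w) + gain v w

data Fires {k : ℕ} : Config k → List (Vertex k) → Config k → Set where
  done : ∀ {C} → Fires C [] C
  step : ∀ {C v vs D} → suc k ≤ C v → Fires (fire v C) vs D → Fires C (v ∷ vs) D

Stable : {k : ℕ} → Config k → Set
Stable {k} D = ∀ v → D v < suc k

initial : {k : ℕ} → ℕ → Config k
initial N w = if does (isRoot w) then N else 0

fireCount : {k : ℕ} → Vertex k → List (Vertex k) → ℕ
fireCount v vs = length (filter (λ u → u ≟V v) vs)

layerVertex : {k : ℕ} → 0 < k → ℕ → Vertex k
layerVertex 0<k i = replicate i (fromℕ< 0<k)

-- (k^j - 1)/(k - 1)  (only used for k ≥ 2)
geom : ℕ → ℕ → ℕ
geom (suc (suc m)) j = (suc (suc m) ^ j ∸ 1) / suc m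
geom _ j = 0

{-# OPTIONS --safe #-}
-- The c_i are the digits of N in bijective base k (1 ≤ c_i ≤ k), and the claimed firing numbers
-- satisfy f_i = f_(i+1) + T_(i+1), where T_i = Σ_j k^j c_(i+j) is the number of chips in the subtree
-- of a vertex on layer i + 1. With these recurrences, firing every vertex of layer i + 1 exactly
-- f_i times turns N chips at the root into the stable configuration with c_i chips on layer i + 1,
-- as an identity of chip counts that ignores legality. By the least action principle a legal
-- firing sequence fires no vertex more often than that. The deficit h = f − (actual firings) then
-- turns the stable final configuration into one with a chip wherever h > 0, is bounded, and
-- vanishes below layer n; a maximum principle forces h = 0.
module Submission where

open import Defs
open import Data.Nat using (ℕ; suc; s≤s; z≤n; _+_; _*_; _∸_; _^_; _≤_; _<_)
open import Data.Nat.Properties using (<-trans)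
open import Data.List using (List; length; map; applyUpTo)
open import Data.Nat.ListAction using (sum)
open import Relation.Binary.PropositionalEquality using (_≡_)

open import Data.Nat using (zero; s≤s⁻¹)
open import Data.Nat.Properties
  using ( +-*-semiring; ≤-refl; ≤-trans; ≤-antisym; ≤-reflexive; ≤∧≢⇒<; ≰⇒>; 1+n≰n; n≤0⇒n≡0
        ; m≤m+n; m≤n⇒m≤1+n; +-mono-≤; +-monoʳ-≤; +-identityʳ; +-assoc; +-comm; +-suc; *-comm; *-identityʳ
        ; *-zeroʳ; *-assoc; *-distribʳ-+; +-cancelʳ-≡; +-cancelʳ-≤; +-cancelʳ-<; *-cancelʳ-≤
        ; *-cancelʳ-<; 0∸n≡0; m∸n≤m; m∸n+n≡m; m+[n∸m]≡n; m+n∸n≡m; m≤n⇒m∸n≡0; m∸n≡0⇒m≤n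
        ; +-∸-assoc; <-≤-connex; module ≤-Reasoning)
open import Data.Nat.DivMod using (_/_; _%_; m≡m%n+[m/n]*n; m%n<n; m*n/n≡m; /-monoˡ-≤; m<n*o⇒m/o<n)
open import Data.Nat.Tactic.RingSolver using (solve-∀)
open import Data.Fin using (Fin; toℕ) renaming (zero to fzero; suc to fsuc)
open import Data.Fin.Properties using (0≢1+n; suc-injective)
open import Data.List using ([]; _∷_)
open import Data.List.Properties using (map-cong; length-replicate; ∷-injectiveˡ; ∷-injectiveʳ)
open import Data.Bool using (if_then_else_)
open import Data.Bool.Properties using (if-eta)
open import Data.Product using (_×_; _,_; proj₁; proj₂; uncurry)
open import Data.Sum using (inj₁; inj₂)
open import Data.Empty using (⊥)
open import Function using (_∘_; _⇔_; mk⇔; Equivalence)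
open import Relation.Nullary using (Dec; yes; no; does; ¬_; contradiction)
open import Relation.Binary.PropositionalEquality using (refl; sym; trans; cong; cong₂; subst; _≗_; module ≡-Reasoning)
open import Algebra.Properties.Semiring.Sum +-*-semiring
  using (sum-syntax; sum-cong-≗; ∑-distrib-+; *-distribˡ-sum)

open Equivalence using (to; from)

ind-yes : {A : Set} → A → (d : Dec A) → ind d ≡ 1
ind-yes a (yes _) = refl
ind-yes a (no ¬a) = contradiction a ¬a

ind-no : {A : Set} → ¬ A → (d : Dec A) → ind d ≡ 0
ind-no ¬a (yes a) = contradiction a ¬a
ind-no ¬a (no _)  = refl

ind-⇔ : {A B : Set} → A ⇔ B → (d : Dec A) (e : Dec B) → ind d ≡ ind e
ind-⇔ A⇔B (yes a) e = sym (ind-yes (to A⇔B a) e)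
ind-⇔ A⇔B (no ¬a) e = sym (ind-no (¬a ∘ from A⇔B) e)

∑-const : ∀ n x → ∑[ a < n ] x ≡ n * x
∑-const zero    x = refl
∑-const (suc n) x = cong (x +_) (∑-const n x)

∑-mono-≤ : ∀ {n} {f g : Fin n → ℕ} → (∀ a → f a ≤ g a) → ∑[ a < n ] f a ≤ ∑[ a < n ] g a
∑-mono-≤ {zero}  f≤g = z≤n
∑-mono-≤ {suc n} f≤g = +-mono-≤ (f≤g fzero) (∑-mono-≤ (f≤g ∘ fsuc))

∑-ind-∅ : ∀ {n} {P : Fin n → Set} (P? : ∀ a → Dec (P a)) → (∀ a → ¬ P a) →
          ∑[ a < n ] ind (P? a) ≡ 0
∑-ind-∅ {zero}  P? ¬P = refl
∑-ind-∅ {suc n} P? ¬P = cong₂ _+_ (ind-no (¬P fzero) (P? fzero)) (∑-ind-∅ (P? ∘ fsuc) (¬P ∘ fsuc))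

∑-ind-unique : ∀ {n} (b : Fin n) {P : Fin n → Set} (P? : ∀ a → Dec (P a)) → (∀ a → P a ⇔ b ≡ a) →
               ∑[ a < n ] ind (P? a) ≡ 1
∑-ind-unique fzero P? P⇔ =
  cong₂ _+_ (ind-yes (from (P⇔ fzero) refl) (P? fzero))
            (∑-ind-∅ (P? ∘ fsuc) (λ a → 0≢1+n ∘ to (P⇔ (fsuc a))))
∑-ind-unique (fsuc b) P? P⇔ =
  cong₂ _+_ (ind-no (0≢1+n ∘ sym ∘ to (P⇔ fzero)) (P? fzero))
            (∑-ind-unique b (P? ∘ fsuc) (λ a → mk⇔ (suc-injective ∘ to (P⇔ (fsuc a)))
                                                   (from (P⇔ (fsuc a)) ∘ cong fsuc)))

sum-map-applyUpTo : ∀ (h g : ℕ → ℕ) M → sum (map h (applyUpTo g M)) ≡ ∑[ j < M ] h (g (toℕ j))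
sum-map-applyUpTo h g zero    = refl
sum-map-applyUpTo h g (suc M) = cong (h (g 0) +_) (sum-map-applyUpTo h (g ∘ suc) M)

module Tree (k : ℕ) where

  parent : Vertex k → Vertex k
  parent []      = []
  parent (_ ∷ v) = v

  -- The self-loop makes the root its own parent.
  neighbourSum : Config k → Vertex k → ℕ
  neighbourSum F w = F (parent w) + ∑[ a < k ] F (a ∷ w)

  neighbourSum-cong : ∀ {F G : Config k} → F ≗ G → neighbourSum F ≗ neighbourSum G
  neighbourSum-cong F≗G w = cong₂ _+_ (F≗G (parent w)) (sum-cong-≗ (F≗G ∘ (_∷ w)))

  neighbourSum-mono-≤ : ∀ {F G : Config k} → (∀ w → F w ≤ G w) → ∀ w → neighbourSum F w ≤ neighbourSum G w
  neighbourSum-mono-≤ F≤G w = +-mono-≤ (F≤G (parent w)) (∑-mono-≤ (F≤G ∘ (_∷ w)))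

  neighbourSum-+ : ∀ (F G : Config k) w →
                   neighbourSum (λ u → F u + G u) w ≡ neighbourSum F w + neighbourSum G w
  neighbourSum-+ F G w =
    trans (cong (F (parent w) + G (parent w) +_) (∑-distrib-+ (F ∘ (_∷ w)) (G ∘ (_∷ w))))
          (interchange (F (parent w)) (G (parent w)) (∑[ a < k ] F (a ∷ w)) (∑[ a < k ] G (a ∷ w)))
    where
    interchange : ∀ a b c d → (a + b) + (c + d) ≡ (a + c) + (b + d)
    interchange = solve-∀

  δ : Vertex k → Config k
  δ v u = ind (v ≟V u)

  δ-sym : ∀ u v → δ u v ≡ δ v u
  δ-sym u v = ind-⇔ (mk⇔ sym sym) (u ≟V v) (v ≟V u)

  ∑-δ-root : ∀ w → ∑[ a < k ] δ [] (a ∷ w) ≡ 0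
  ∑-δ-root w = ∑-ind-∅ (λ a → [] ≟V (a ∷ w)) (λ a ())

  ∑-δ-child : ∀ b v w → ∑[ a < k ] δ (b ∷ v) (a ∷ w) ≡ δ v w
  ∑-δ-child b v w = by-cases (v ≟V w)
    where
    by-cases : Dec (v ≡ w) → ∑[ a < k ] δ (b ∷ v) (a ∷ w) ≡ δ v w
    by-cases (yes v≡w) =
      trans (∑-ind-unique b (λ a → (b ∷ v) ≟V (a ∷ w))
                          (λ a → mk⇔ ∷-injectiveˡ (λ b≡a → cong₂ _∷_ b≡a v≡w)))
            (sym (ind-yes v≡w (v ≟V w)))
    by-cases (no v≢w) =
      trans (∑-ind-∅ (λ a → (b ∷ v) ≟V (a ∷ w)) (λ a → v≢w ∘ ∷-injectiveʳ)) (sym (ind-no v≢w (v ≟V w)))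

  gain≡neighbourSum-δ : ∀ v w → gain v w ≡ neighbourSum (δ v) w
  gain≡neighbourSum-δ []      []      = cong suc (sym (∑-δ-root []))
  gain≡neighbourSum-δ []      (p ∷ w) = cong₂ _+_ (δ-sym w []) (sym (∑-δ-root (p ∷ w)))
  gain≡neighbourSum-δ (b ∷ v) []      = sym (∑-δ-child b v [])
  gain≡neighbourSum-δ (b ∷ v) (p ∷ w) =
    cong₂ _+_ (trans (cong (_+ δ w (b ∷ v)) (if-eta _)) (δ-sym w (b ∷ v))) (sym (∑-δ-child b v (p ∷ w)))

  chips-kept : ∀ {C : Config k} v → suc k ≤ C v → ∀ w →
               (if does (w ≟V v) then C w ∸ suc k else C w) + suc k * δ v w ≡ C w
  chips-kept {C} v k<Cv w = by-cases (w ≟V v)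
    where
    by-cases : (d : Dec (w ≡ v)) → (if does d then C w ∸ suc k else C w) + suc k * δ v w ≡ C w
    by-cases (yes w≡v) = begin
      C w ∸ suc k + suc k * δ v w ≡⟨ cong (λ x → C w ∸ suc k + suc k * x) (ind-yes (sym w≡v) (v ≟V w)) ⟩
      C w ∸ suc k + suc k * 1     ≡⟨ cong (C w ∸ suc k +_) (*-identityʳ (suc k)) ⟩
      C w ∸ suc k + suc k         ≡⟨ m∸n+n≡m (subst (λ u → suc k ≤ C u) (sym w≡v) k<Cv) ⟩
      C w                         ∎
      where open ≡-Reasoning
    by-cases (no w≢v) = begin
      C w + suc k * δ v w ≡⟨ cong (λ x → C w + suc k * x) (ind-no (w≢v ∘ sym) (v ≟V w)) ⟩
      C w + suc k * 0     ≡⟨ cong (C w +_) (*-zeroʳ (suc k)) ⟩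
      C w + 0             ≡⟨ +-identityʳ (C w) ⟩
      C w                 ∎
      where open ≡-Reasoning

  fireCount-∷ : ∀ v w vs → fireCount w (v ∷ vs) ≡ δ v w + fireCount w vs
  fireCount-∷ v w vs with v ≟V w
  ... | yes _ = refl
  ... | no  _ = refl

  -- Balanced C₀ F C: firing every vertex w exactly F w times turns C₀ into C,
  -- with the chips w loses moved to the left so that no subtraction occurs.
  record Balanced (C₀ F C : Config k) : Set where
    field balance : ∀ w → C w + suc k * F w ≡ C₀ w + neighbourSum F w
  open Balanced public

  Balanced-cong : ∀ {C₀ F G C} → F ≗ G → Balanced C₀ F C → Balanced C₀ G C
  Balanced-cong {C₀} {F} {G} {C} F≗G bal .balance w = begin
    C w + suc k * G w          ≡⟨ cong (λ x → C w + suc k * x) (sym (F≗G w)) ⟩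
    C w + suc k * F w          ≡⟨ balance bal w ⟩
    C₀ w + neighbourSum F w    ≡⟨ cong (C₀ w +_) (neighbourSum-cong F≗G w) ⟩
    C₀ w + neighbourSum G w    ∎
    where open ≡-Reasoning

  Balanced-zero : ∀ C → Balanced C (λ _ → 0) C
  Balanced-zero C .balance w = cong (C w +_) (trans (*-zeroʳ (suc k)) (sym (trans (∑-const k 0) (*-zeroʳ k))))

  fire-balanced : ∀ {C₀ F C} v → suc k ≤ C v → Balanced C₀ F C → Balanced C₀ (λ u → F u + δ v u) (fire v C)
  fire-balanced {C₀} {F} {C} v k<Cv bal .balance w = begin
    fire v C w + suc k * (F w + δ v w)                ≡⟨ rearrange kept (gain v w) (suc k) (F w) (δ v w) ⟩
    (kept + suc k * δ v w) + (suc k * F w + gain v w) ≡⟨ cong (_+ (suc k * F w + gain v w)) (chips-kept v k<Cv w) ⟩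
    C w + (suc k * F w + gain v w)                    ≡⟨ sym (+-assoc (C w) _ _) ⟩
    (C w + suc k * F w) + gain v w                    ≡⟨ cong₂ _+_ (balance bal w) (gain≡neighbourSum-δ v w) ⟩
    (C₀ w + neighbourSum F w) + neighbourSum (δ v) w  ≡⟨ +-assoc (C₀ w) _ _ ⟩
    C₀ w + (neighbourSum F w + neighbourSum (δ v) w)  ≡⟨ cong (C₀ w +_) (sym (neighbourSum-+ F (δ v) w)) ⟩
    C₀ w + neighbourSum (λ u → F u + δ v u) w         ∎
    where
    open ≡-Reasoning
    kept : ℕ
    kept = if does (w ≟V v) then C w ∸ suc k else C w
    rearrange : ∀ c g s f d → c + g + s * (f + d) ≡ (c + s * d) + (s * f + g)
    rearrange = solve-∀

  fires-balanced : ∀ {C₀ F C vs D} → Fires C vs D → Balanced C₀ F C →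
                   Balanced C₀ (λ w → F w + fireCount w vs) D
  fires-balanced done bal = Balanced-cong (λ w → sym (+-identityʳ _)) bal
  fires-balanced {C₀} {F} (step {v = v} {vs = vs} k<Cv fs) bal =
    Balanced-cong (λ w → trans (+-assoc (F w) _ _) (cong (F w +_) (sym (fireCount-∷ v w vs))))
                  (fires-balanced fs (fire-balanced v k<Cv bal))

  odometer-balanced : ∀ {C₀ vs D} → Fires C₀ vs D → Balanced C₀ (λ w → fireCount w vs) D
  odometer-balanced fs = fires-balanced fs (Balanced-zero _)

  Balanced-functional : ∀ {C₀ F G C D} → Balanced C₀ F C → Balanced C₀ G D → F ≗ G → C ≗ D
  Balanced-functional {C₀} {F} {G} {C} {D} balF balG F≗G w = +-cancelʳ-≡ (suc k * F w) (C w) (D w) (begin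
    C w + suc k * F w        ≡⟨ balance balF w ⟩
    C₀ w + neighbourSum F w  ≡⟨ cong (C₀ w +_) (neighbourSum-cong F≗G w) ⟩
    C₀ w + neighbourSum G w  ≡⟨ sym (balance balG w) ⟩
    D w + suc k * G w        ≡⟨ cong (λ x → D w + suc k * x) (sym (F≗G w)) ⟩
    D w + suc k * F w        ∎)
    where open ≡-Reasoning

  Balanced-∸ : ∀ {C₀ F G C D} → Balanced C₀ F C → Balanced C₀ G D → (∀ w → G w ≤ F w) →
               Balanced D (λ w → F w ∸ G w) C
  Balanced-∸ {C₀} {F} {G} {C} {D} balF balG G≤F .balance w = +-cancelʳ-≡ (suc k * G w) _ _ (begin
    C w + suc k * h w + suc k * G w         ≡⟨ rearrange (C w) (suc k) (h w) (G w) ⟩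
    C w + suc k * (G w + h w)               ≡⟨ cong (λ x → C w + suc k * x) (m+[n∸m]≡n (G≤F w)) ⟩
    C w + suc k * F w                       ≡⟨ balance balF w ⟩
    C₀ w + neighbourSum F w                 ≡⟨ cong (C₀ w +_) (neighbourSum-cong F≗G+h w) ⟩
    C₀ w + neighbourSum (λ u → G u + h u) w ≡⟨ cong (C₀ w +_) (neighbourSum-+ G h w) ⟩
    C₀ w + (neighbourSum G w + neighbourSum h w) ≡⟨ sym (+-assoc (C₀ w) _ _) ⟩
    C₀ w + neighbourSum G w + neighbourSum h w   ≡⟨ cong (_+ neighbourSum h w) (sym (balance balG w)) ⟩
    D w + suc k * G w + neighbourSum h w    ≡⟨ rearrange′ (D w) (suc k * G w) (neighbourSum h w) ⟩
    D w + neighbourSum h w + suc k * G w    ∎)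
    where
    open ≡-Reasoning
    h : Config k
    h u = F u ∸ G u
    F≗G+h : F ≗ (λ u → G u + h u)
    F≗G+h u = sym (m+[n∸m]≡n (G≤F u))
    rearrange : ∀ c s x g → c + s * x + s * g ≡ c + s * (g + x)
    rearrange = solve-∀
    rearrange′ : ∀ d x y → d + x + y ≡ d + y + x
    rearrange′ = solve-∀

  -- If G v = F v, then v's neighbours have fired no more under G than under F,
  -- so v holds no more chips in C′ than in the stable C.
  fireable⇒below : ∀ {C₀ F C G C′ v} → Balanced C₀ F C → Stable C → Balanced C₀ G C′ →
                   (∀ w → G w ≤ F w) → suc k ≤ C′ v → G v < F v
  fireable⇒below {C₀} {F} {C} {G} {C′} {v} balF stable balG G≤F k<C′v =
    ≤∧≢⇒< (G≤F v) λ G≡F → 1+n≰n (≤-trans k<C′v (+-cancelʳ-≤ (suc k * G v) (C′ v) k (begin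
      C′ v + suc k * G v         ≡⟨ balance balG v ⟩
      C₀ v + neighbourSum G v    ≤⟨ +-monoʳ-≤ (C₀ v) (neighbourSum-mono-≤ G≤F v) ⟩
      C₀ v + neighbourSum F v    ≡⟨ sym (balance balF v) ⟩
      C v + suc k * F v          ≤⟨ +-mono-≤ (s≤s⁻¹ (stable v)) (≤-reflexive (cong (suc k *_) (sym G≡F))) ⟩
      k + suc k * G v            ∎)))
    where open ≤-Reasoning

  leastAction : ∀ {C₀ F C vs D} → Balanced C₀ F C → Stable C → Fires C₀ vs D → ∀ w → fireCount w vs ≤ F w
  leastAction {C₀} {F} {C} balF stable fs = go fs (Balanced-zero C₀) (λ _ → z≤n)
    where
    go : ∀ {G C′ us D} → Fires C′ us D → Balanced C₀ G C′ → (∀ w → G w ≤ F w) →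
         ∀ w → G w + fireCount w us ≤ F w
    go {G} done _ G≤F w = subst (_≤ F w) (sym (+-identityʳ (G w))) (G≤F w)
    go {G} {C′} (step {v = v} {vs = us} k<C′v fs′) balG G≤F w =
      subst (_≤ F w) (trans (+-assoc (G w) _ _) (cong (G w +_) (sym (fireCount-∷ v w us))))
            (go fs′ (fire-balanced v k<C′v balG) G+δ≤F w)
      where
      G+δ≤F : ∀ u → G u + δ v u ≤ F u
      G+δ≤F u with v ≟V u
      ... | yes refl = subst (_≤ F u) (+-comm 1 (G u)) (fireable⇒below balF stable balG G≤F k<C′v)
      ... | no  _    = subst (_≤ F u) (sym (+-identityʳ (G u))) (G≤F u)

  -- If h w = B + 1 while h ≤ B on the children of w, then
  -- C w = D w + (chips received) − (chips sent) ≤ k + ((B + 1) + k B) − (k + 1)(B + 1) = 0.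
  -- Induction on the distance to depth L rules such peaks out, lowering the bound B.
  maximumPrinciple : ∀ {D h C} L B → Stable D → Balanced D h C → (∀ w → 1 ≤ h w → 1 ≤ C w) →
                     (∀ w → L ≤ length w → h w ≡ 0) → (∀ w → h w ≤ B) → ∀ w → h w ≡ 0
  maximumPrinciple L zero    _ _ _ _ h≤0 w = n≤0⇒n≡0 (h≤0 w)
  maximumPrinciple {D} {h} {C} L (suc B) stable bal occupied deep h≤1+B =
    maximumPrinciple L B stable bal occupied deep (λ w → h≤B L w (m≤m+n L (length w)))
    where
    open ≤-Reasoning
    no-peak : ∀ w → h w ≡ suc B → (∀ a → h (a ∷ w) ≤ B) → ⊥
    no-peak w hw≡1+B children≤B = 1+n≰n (begin
      1 + suc k * suc B                ≤⟨ +-mono-≤ (occupied w 1≤hw) (≤-reflexive (cong (suc k *_) (sym hw≡1+B))) ⟩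
      C w + suc k * h w                ≡⟨ balance bal w ⟩
      D w + neighbourSum h w           ≤⟨ +-mono-≤ (s≤s⁻¹ (stable w)) (+-mono-≤ (h≤1+B (parent w)) (∑-mono-≤ children≤B)) ⟩
      k + (suc B + ∑[ a < k ] B)       ≡⟨ cong (λ x → k + (suc B + x)) (∑-const k B) ⟩
      k + (suc B + k * B)              ≡⟨ regroup k B ⟩
      suc k * suc B                    ∎)
      where
      1≤hw : 1 ≤ h w
      1≤hw = subst (1 ≤_) (sym hw≡1+B) (s≤s z≤n)
      regroup : ∀ k B → k + (suc B + k * B) ≡ suc k * suc B
      regroup = solve-∀
    h≤B : ∀ r w → L ≤ r + length w → h w ≤ B
    h≤B zero    w L≤ = subst (_≤ B) (sym (deep w L≤)) z≤n
    h≤B (suc r) w L≤ = s≤s⁻¹ (≤∧≢⇒< (h≤1+B w) λ hw≡1+B →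
      no-peak w hw≡1+B (λ a → h≤B r (a ∷ w) (subst (L ≤_) (sym (+-suc r (length w))) L≤)))

  firingOutcome : ∀ {C₀ F C vs D} L B → Balanced C₀ F C → Stable C → (∀ w → length w < L → 1 ≤ C w) →
                  (∀ w → L ≤ length w → F w ≡ 0) → (∀ w → F w ≤ B) → Fires C₀ vs D → Stable D →
                  (∀ w → fireCount w vs ≡ F w) × (∀ w → D w ≡ C w)
  firingOutcome {C₀} {F} {C} {vs} {D} L B balF stableC occupied deep bounded fs stableD =
    fireCount≗F , λ w → sym (Balanced-functional balF balD (λ u → sym (fireCount≗F u)) w)
    where
    balD : Balanced C₀ (λ w → fireCount w vs) D
    balD = odometer-balanced fs
    fireCount≤F : ∀ w → fireCount w vs ≤ F w
    fireCount≤F = leastAction balF stableC fs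
    h : Config k
    h w = F w ∸ fireCount w vs
    h-deep : ∀ w → L ≤ length w → h w ≡ 0
    h-deep w L≤ = trans (cong (_∸ fireCount w vs) (deep w L≤)) (0∸n≡0 (fireCount w vs))
    h-occupied : ∀ w → 1 ≤ h w → 1 ≤ C w
    h-occupied w 1≤hw = occupied w (≰⇒> λ L≤ → 1+n≰n (subst (1 ≤_) (h-deep w L≤) 1≤hw))
    h≡0 : ∀ w → h w ≡ 0
    h≡0 = maximumPrinciple L B stableD (Balanced-∸ balF balD fireCount≤F) h-occupied h-deep
                           (λ w → ≤-trans (m∸n≤m (F w) (fireCount w vs)) (bounded w))
    fireCount≗F : ∀ w → fireCount w vs ≡ F w
    fireCount≗F w = ≤-antisym (fireCount≤F w) (m∸n≡0⇒m≤n (h≡0 w))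

  balanced-by-layers : ∀ {N} (c f : ℕ → ℕ) →
                       c 0 + suc k * f 0 ≡ N + (f 0 + k * f 1) →
                       (∀ d → c (suc d) + suc k * f (suc d) ≡ f d + k * f (suc (suc d))) →
                       Balanced (initial N) (f ∘ length) (c ∘ length)
  balanced-by-layers {N} c f root layer .balance []      =
    trans root (cong (λ x → N + (f 0 + x)) (sym (∑-const k (f 1))))
  balanced-by-layers {N} c f root layer .balance (_ ∷ w) =
    trans (layer (length w)) (cong (f (length w) +_) (sym (∑-const k (f (suc (suc (length w)))))))

weightedSum : (ℕ → ℕ) → (ℕ → ℕ) → ℕ → ℕ
weightedSum ω c M = ∑[ j < M ] (ω (toℕ j) * c (toℕ j))

weightedSum-cong : ∀ ω {c c′ : ℕ → ℕ} → c ≗ c′ → ∀ M → weightedSum ω c M ≡ weightedSum ω c′ M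
weightedSum-cong ω c≗c′ M = sum-cong-≗ {M} (λ j → cong (ω (toℕ j) *_) (c≗c′ (toℕ j)))

weightedSum-^-suc : ∀ K c M → weightedSum (K ^_) c (suc M) ≡ c 0 + K * weightedSum (K ^_) (c ∘ suc) M
weightedSum-^-suc K c M = cong₂ _+_ (+-identityʳ (c 0)) (begin
  ∑[ j < M ] (K * K ^ toℕ j * c′ j)   ≡⟨ sum-cong-≗ {M} (λ j → *-assoc K (K ^ toℕ j) (c′ j)) ⟩
  ∑[ j < M ] (K * (K ^ toℕ j * c′ j)) ≡⟨ sym (*-distribˡ-sum {M} K (λ j → K ^ toℕ j * c′ j)) ⟩
  K * weightedSum (K ^_) (c ∘ suc) M  ∎)
  where
  open ≡-Reasoning
  c′ : Fin M → ℕ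
  c′ j = c (suc (toℕ j))

module _ (m : ℕ) where

  private
    K : ℕ
    K = 2 + m

  geom-unique : ∀ j x → x * suc m + 1 ≡ K ^ j → geom K j ≡ x
  geom-unique j x x[K-1]+1≡K^j = begin
    (K ^ j ∸ 1) / suc m             ≡⟨ cong (λ y → (y ∸ 1) / suc m) (sym x[K-1]+1≡K^j) ⟩
    (x * suc m + 1 ∸ 1) / suc m     ≡⟨ cong (_/ suc m) (m+n∸n≡m (x * suc m) 1) ⟩
    x * suc m / suc m               ≡⟨ m*n/n≡m x (suc m) ⟩
    x                               ∎
    where open ≡-Reasoning

  geom-spec : ∀ j → geom K j * suc m + 1 ≡ K ^ j
  geom-suc : ∀ j → geom K (suc j) ≡ suc (K * geom K j)

  geom-step : ∀ j → suc (K * geom K j) * suc m + 1 ≡ K ^ suc j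
  geom-step j = begin
    suc (K * geom K j) * suc m + 1 ≡⟨ regroup m (geom K j) ⟩
    K * (geom K j * suc m + 1)     ≡⟨ cong (K *_) (geom-spec j) ⟩
    K * K ^ j                      ∎
    where
    open ≡-Reasoning
    regroup : ∀ m g → suc ((2 + m) * g) * suc m + 1 ≡ (2 + m) * (g * suc m + 1)
    regroup = solve-∀

  geom-spec zero    = refl
  geom-spec (suc j) = trans (cong (λ x → x * suc m + 1) (geom-suc j)) (geom-step j)

  geom-suc j = geom-unique (suc j) (suc (K * geom K j)) (geom-step j)

  geom-suc-+ : ∀ j → geom K (suc j) ≡ geom K j + K ^ j
  geom-suc-+ j = begin
    geom K (suc j)                     ≡⟨ geom-suc j ⟩
    suc (K * geom K j)                 ≡⟨ regroup m (geom K j) ⟩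
    geom K j + (geom K j * suc m + 1)  ≡⟨ cong (geom K j +_) (geom-spec j) ⟩
    geom K j + K ^ j                   ∎
    where
    open ≡-Reasoning
    regroup : ∀ m g → suc ((2 + m) * g) ≡ g + (g * suc m + 1)
    regroup = solve-∀

  weightedSum-geom-suc : ∀ c M → weightedSum (geom K) c (suc M) ≡
                         weightedSum (geom K) (c ∘ suc) M + weightedSum (K ^_) (c ∘ suc) M
  weightedSum-geom-suc c M = begin
    ∑[ j < M ] (geom K (suc (toℕ j)) * c′ j)
      ≡⟨ sum-cong-≗ {M} split ⟩
    ∑[ j < M ] (geom K (toℕ j) * c′ j + K ^ toℕ j * c′ j)
      ≡⟨ ∑-distrib-+ {M} (λ j → geom K (toℕ j) * c′ j) (λ j → K ^ toℕ j * c′ j) ⟩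
    weightedSum (geom K) (c ∘ suc) M + weightedSum (K ^_) (c ∘ suc) M ∎
    where
    open ≡-Reasoning
    c′ : Fin M → ℕ
    c′ j = c (suc (toℕ j))
    split : ∀ j → geom K (suc (toℕ j)) * c′ j ≡ geom K (toℕ j) * c′ j + K ^ toℕ j * c′ j
    split j = trans (cong (_* c′ j) (geom-suc-+ (toℕ j))) (*-distribʳ-+ (c′ j) (geom K (toℕ j)) (K ^ toℕ j))

  weightedSum-geom-closedForm : ∀ c M → weightedSum (geom K) c M ≡
                                sum (map (λ j → geom K j * c j) (applyUpTo suc (M ∸ 1)))
  weightedSum-geom-closedForm c zero    = refl
  weightedSum-geom-closedForm c (suc M) = sym (sum-map-applyUpTo (λ j → geom K j * c j) suc M)

-- The paper's c_i = a_i + 1 are the digits of N in bijective base-k numeration.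
record BijectiveDigits (k n N : ℕ) : Set where
  field
    digit      : ℕ → ℕ
    digit-pos  : ∀ {j} → j < n → 1 ≤ digit j
    digit-≤    : ∀ j → digit j ≤ k
    digit-zero : ∀ {j} → n ≤ j → digit j ≡ 0
    value      : weightedSum (k ^_) digit n ≡ N

bijectiveDigits : ∀ m n N → geom (2 + m) n ≤ N → N ≤ (2 + m) * geom (2 + m) n → BijectiveDigits (2 + m) n N
bijectiveDigits m zero N _ N≤0 = record
  { digit      = λ _ → 0
  ; digit-pos  = λ ()
  ; digit-≤    = λ _ → z≤n
  ; digit-zero = λ _ → refl
  ; value      = sym (n≤0⇒n≡0 (subst (N ≤_) (*-zeroʳ (2 + m)) N≤0))
  }
bijectiveDigits m (suc n) zero lo _ = contradiction (subst (_≤ 0) (geom-suc m n) lo) λ ()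
bijectiveDigits m (suc n) (suc N) lo hi = record
  { digit      = digit
  ; digit-pos  = λ { {zero} _ → s≤s z≤n ; {suc j} j<n → digit-pos (s≤s⁻¹ j<n) }
  ; digit-≤    = λ { zero → m%n<n N K ; (suc j) → digit-≤ j }
  ; digit-zero = λ { {suc j} n≤j → digit-zero (s≤s⁻¹ n≤j) }
  ; value      = begin
      weightedSum (K ^_) digit (suc n)                 ≡⟨ weightedSum-^-suc K digit n ⟩
      suc (N % K) + K * weightedSum (K ^_) digit′ n    ≡⟨ cong (λ x → suc (N % K) + K * x) value′ ⟩
      suc (N % K) + K * (N / K)          ≡⟨ cong (λ x → suc (N % K + x)) (*-comm K (N / K)) ⟩
      suc (N % K + N / K * K)            ≡⟨ cong suc (sym (m≡m%n+[m/n]*n N K)) ⟩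
      suc N                              ∎
  }
  where
  open ≡-Reasoning
  K : ℕ
  K = 2 + m
  K*g≤N : K * geom K n ≤ N
  K*g≤N = s≤s⁻¹ (subst (_≤ suc N) (geom-suc m n) lo)
  N<[1+K*g]*K : N < suc (K * geom K n) * K
  N<[1+K*g]*K = subst (suc N ≤_) (trans (cong (K *_) (geom-suc m n)) (*-comm K _)) hi
  quotient : BijectiveDigits K n (N / K)
  quotient = bijectiveDigits m n (N / K)
    (subst (_≤ N / K) (m*n/n≡m (geom K n) K) (/-monoˡ-≤ K (subst (_≤ N) (*-comm K (geom K n)) K*g≤N)))
    (s≤s⁻¹ (m<n*o⇒m/o<n N<[1+K*g]*K))
  open BijectiveDigits quotient using (digit-pos; digit-≤; digit-zero) renaming (digit to digit′; value to value′)
  digit : ℕ → ℕ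
  digit zero    = suc (N % K)
  digit (suc j) = digit′ j

geom-bounds : ∀ m n N → (2 + m) ^ n ≤ N * suc m + 1 → N * suc m + 1 < (2 + m) ^ suc n →
                 geom (2 + m) n ≤ N × N ≤ (2 + m) * geom (2 + m) n
geom-bounds m n N lo hi =
  *-cancelʳ-≤ (geom (2 + m) n) N (suc m)
    (+-cancelʳ-≤ 1 _ _ (subst (_≤ N * suc m + 1) (sym (geom-spec m n)) lo)) ,
  s≤s⁻¹ (subst (N <_) (geom-suc m n) (*-cancelʳ-< (suc m) N (geom (2 + m) (suc n))
    (+-cancelʳ-< 1 _ _ (subst (N * suc m + 1 <_) (sym (geom-spec m (suc n))) hi))))

module Candidate {m n N : ℕ} (digits : BijectiveDigits (2 + m) n N) where

  open BijectiveDigits digits renaming (digit to c)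
  open Tree (2 + m)

  private
    K : ℕ
    K = 2 + m

  suffixSum : (ℕ → ℕ) → ℕ → ℕ
  suffixSum ω d = weightedSum ω (λ j → c (d + j)) (n ∸ d)

  subtreeChips : ℕ → ℕ
  subtreeChips = suffixSum (K ^_)

  firesAt : ℕ → ℕ
  firesAt = suffixSum (geom K)

  suffixSum-beyond : ∀ ω {d} → n ≤ d → suffixSum ω d ≡ 0
  suffixSum-beyond ω {d} n≤d = cong (weightedSum ω (λ j → c (d + j))) (m≤n⇒m∸n≡0 n≤d)

  suffixSum-within : ∀ ω {d} → d < n → suffixSum ω d ≡ weightedSum ω (λ j → c (d + j)) (suc (n ∸ suc d))
  suffixSum-within ω {d} d<n = cong (weightedSum ω (λ j → c (d + j))) (+-∸-assoc 1 d<n)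

  shift-suc : ∀ d → (λ j → c (d + suc j)) ≗ (λ j → c (suc d + j))
  shift-suc d j = cong c (+-suc d j)

  subtreeChips-step : ∀ d → subtreeChips d ≡ c d + K * subtreeChips (suc d)
  subtreeChips-step d with <-≤-connex d n
  ... | inj₁ d<n = begin
    subtreeChips d
      ≡⟨ suffixSum-within (K ^_) d<n ⟩
    weightedSum (K ^_) (λ j → c (d + j)) (suc (n ∸ suc d))
      ≡⟨ weightedSum-^-suc K (λ j → c (d + j)) (n ∸ suc d) ⟩
    c (d + 0) + K * weightedSum (K ^_) (λ j → c (d + suc j)) (n ∸ suc d)
      ≡⟨ cong₂ (λ x y → c x + K * y) (+-identityʳ d) (weightedSum-cong (K ^_) (shift-suc d) (n ∸ suc d)) ⟩
    c d + K * subtreeChips (suc d) ∎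
    where open ≡-Reasoning
  ... | inj₂ n≤d = begin
    subtreeChips d                 ≡⟨ suffixSum-beyond (K ^_) n≤d ⟩
    0                              ≡⟨ sym (*-zeroʳ K) ⟩
    0 + K * 0                      ≡⟨ sym (cong₂ (λ x y → x + K * y) (digit-zero n≤d) (suffixSum-beyond (K ^_) n≤1+d)) ⟩
    c d + K * subtreeChips (suc d) ∎
    where
    open ≡-Reasoning
    n≤1+d : n ≤ suc d
    n≤1+d = m≤n⇒m≤1+n n≤d

  firesAt-step : ∀ d → firesAt d ≡ firesAt (suc d) + subtreeChips (suc d)
  firesAt-step d with <-≤-connex d n
  ... | inj₁ d<n = begin
    firesAt d
      ≡⟨ suffixSum-within (geom K) d<n ⟩
    weightedSum (geom K) (λ j → c (d + j)) (suc M)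
      ≡⟨ weightedSum-geom-suc m (λ j → c (d + j)) M ⟩
    weightedSum (geom K) (λ j → c (d + suc j)) M + weightedSum (K ^_) (λ j → c (d + suc j)) M
      ≡⟨ cong₂ _+_ (weightedSum-cong (geom K) (shift-suc d) M) (weightedSum-cong (K ^_) (shift-suc d) M) ⟩
    firesAt (suc d) + subtreeChips (suc d)
      ∎
    where
    open ≡-Reasoning
    M : ℕ
    M = n ∸ suc d
  ... | inj₂ n≤d = trans (suffixSum-beyond (geom K) n≤d)
    (sym (cong₂ _+_ (suffixSum-beyond (geom K) n≤1+d) (suffixSum-beyond (K ^_) n≤1+d)))
    where
    n≤1+d : n ≤ suc d
    n≤1+d = m≤n⇒m≤1+n n≤d

  firesAt-≤ : ∀ d → firesAt d ≤ firesAt 0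
  firesAt-≤ zero    = ≤-refl
  firesAt-≤ (suc d) = ≤-trans (subst (firesAt (suc d) ≤_) (sym (firesAt-step d)) (m≤m+n _ _)) (firesAt-≤ d)

  candidate-balanced : Balanced (initial N) (firesAt ∘ length) (c ∘ length)
  candidate-balanced = balanced-by-layers c firesAt root layer
    where
    open ≡-Reasoning
    root : c 0 + suc K * firesAt 0 ≡ N + (firesAt 0 + K * firesAt 1)
    root = begin
      c 0 + suc K * firesAt 0
        ≡⟨ cong (λ x → c 0 + suc K * x) (firesAt-step 0) ⟩
      c 0 + suc K * (firesAt 1 + subtreeChips 1)
        ≡⟨ regroup K (c 0) (firesAt 1) (subtreeChips 1) ⟩
      (c 0 + K * subtreeChips 1) + ((firesAt 1 + subtreeChips 1) + K * firesAt 1)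
        ≡⟨ cong₂ (λ x y → x + (y + K * firesAt 1)) (trans (sym (subtreeChips-step 0)) value) (sym (firesAt-step 0)) ⟩
      N + (firesAt 0 + K * firesAt 1) ∎
      where
      regroup : ∀ K c f T → c + suc K * (f + T) ≡ (c + K * T) + ((f + T) + K * f)
      regroup = solve-∀
    layer : ∀ d → c (suc d) + suc K * firesAt (suc d) ≡ firesAt d + K * firesAt (suc (suc d))
    layer d = begin
      c (1 + d) + suc K * firesAt (1 + d)
        ≡⟨ cong (λ x → c (1 + d) + suc K * x) (firesAt-step (1 + d)) ⟩
      c (1 + d) + suc K * (firesAt (2 + d) + subtreeChips (2 + d))
        ≡⟨ regroup K (c (1 + d)) (firesAt (2 + d)) (subtreeChips (2 + d)) ⟩
      (firesAt (2 + d) + subtreeChips (2 + d)) + (c (1 + d) + K * subtreeChips (2 + d)) + K * firesAt (2 + d)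
        ≡⟨ cong₂ (λ x y → x + y + K * firesAt (2 + d)) (sym (firesAt-step (1 + d))) (sym (subtreeChips-step (1 + d))) ⟩
      firesAt (1 + d) + subtreeChips (1 + d) + K * firesAt (2 + d)
        ≡⟨ cong (_+ K * firesAt (2 + d)) (sym (firesAt-step d)) ⟩
      firesAt d + K * firesAt (2 + d) ∎
      where
      regroup : ∀ K c f T → c + suc K * (f + T) ≡ (f + T) + (c + K * T) + K * f
      regroup = solve-∀

  candidate-outcome : ∀ {vs D} → Fires (initial N) vs D → Stable D →
                      (∀ w → fireCount w vs ≡ firesAt (length w)) × (∀ w → D w ≡ c (length w))
  candidate-outcome = firingOutcome n (firesAt 0) candidate-balanced (λ w → s≤s (digit-≤ (length w)))
    (λ w → digit-pos) (λ w → suffixSum-beyond (geom K)) (firesAt-≤ ∘ length)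

mainTheorem4 : (k : ℕ) (k≥2 : 2 ≤ k) (N : ℕ) → 1 ≤ N →
    (n : ℕ) → k ^ n ≤ N * (k ∸ 1) + 1 → N * (k ∸ 1) + 1 < k ^ suc n →
    (vs : List (Vertex k)) (D : Config k) →
    Fires (initial N) vs D → Stable D →
    (i : ℕ) (v : Vertex k) → length v ≡ i →
    fireCount v vs ≡
      sum (map (λ j → geom k j * D (layerVertex (<-trans (s≤s z≤n) k≥2) (i + j)))
               (applyUpTo suc (n ∸ i ∸ 1)))
mainTheorem4 .(2 + m) k≥2@(s≤s (s≤s (z≤n {m}))) N _ n lo hi vs D fires stable .(length v) v refl = begin
  fireCount v vs
    ≡⟨ proj₁ outcome v ⟩
  firesAt (length v)
    ≡⟨ weightedSum-geom-closedForm m (λ j → c (length v + j)) (n ∸ length v) ⟩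
  sum (map (λ j → geom (2 + m) j * c (length v + j)) js)
    ≡⟨ cong sum (map-cong (λ j → cong (geom (2 + m) j *_) (layer-chips (length v + j))) js) ⟩
  sum (map (λ j → geom (2 + m) j * D (layerVertex (<-trans (s≤s z≤n) k≥2) (length v + j))) js) ∎
  where
  open ≡-Reasoning
  js : List ℕ
  js = applyUpTo suc (n ∸ length v ∸ 1)
  digits : BijectiveDigits (2 + m) n N
  digits = uncurry (bijectiveDigits m n N) (geom-bounds m n N lo hi)
  open BijectiveDigits digits using () renaming (digit to c)
  open Candidate digits
  outcome : (∀ w → fireCount w vs ≡ firesAt (length w)) × (∀ w → D w ≡ c (length w))
  outcome = candidate-outcome fires stable
  layer-chips : ∀ d → c d ≡ D (layerVertex (<-trans (s≤s z≤n) k≥2) d)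
  layer-chips d = sym (trans (proj₂ outcome (layerVertex (<-trans (s≤s z≤n) k≥2) d)) (cong c (length-replicate d)))
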